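{- Let $\mathsf{F}$ and $\mathsf{G}$ be species satisfying the two standing conditions below, equipped with splittings $\sigma^{\mathsf{F}}\colon \mathsf{F}\to\mathrm{Split}^{\mathsf{F}}$ and $\sigma^{\mathsf{G}}\colon\mathsf{G}\to\mathrm{Split}^{\mathsf{G}}$, each satisfying the proximity and mergeability properties. Then there exists a unique natural transformation $\eta\colon\mathsf{F}\to\mathsf{G}$ that commutes with the splittings, i.e. such that for every finite set $A$, $$\sigma^{\mathsf{G}}_A\circ\eta_A=\mathrm{Split}^{\eta}_A\circ\sigma^{\mathsf{F}}_A .$$ Moreover, $\eta$ is a natural isomorphism; in particular $\mathsf{F}$ and $\mathsf{G}$ are isomorphic species.
   Context: A species $\mathsf{F}$ assigns to each finite set $A$ a finite set $\mathsf{F}[A]$ and to each bijection $h\colon A\to B$ a map $\mathsf{F}[h]\colon\mathsf{F}[A]\to\mathsf{F}[B]$, functorially ($\mathsf{F}[\mathrm{id}_A]=\mathrm{id}$, $\mathsf{F}[g\circ h]=\mathsf{F}[g]\circ\mathsf{F}[h]$). A natural transformation $\eta\colon\mathsf{F}\to\mathsf{G}$ is a family of maps $\eta_A\colon\mathsf{F}[A]\to\mathsf{G}[A]$ with $\eta_B\circ\mathsf{F}[h]=\mathsf{G}[h]\circ\eta_A$ for every bijection $h\colon A\to B$; it is a natural isomorphism if every $\eta_A$ is a bijection. Standing conditions on a species $\mathsf{F}$: (i) $\mathsf{F}[A]=A$ whenever $|A|\le 1$; (ii) $\mathsf{F}[A]\cap\mathsf{F}[B]=\varnothing$ whenever $A\ne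 B$. For such $\mathsf{F}$, the species $\mathrm{Split}^{\mathsf{F}}$ is defined by: $\mathrm{Split}^{\mathsf{F}}[A]=A$ if $|A|\le1$; if $|A|\ge2$, $\mathrm{Split}^{\mathsf{F}}[A]$ is the set of unordered pairs $\{\ell_1,\ell_2\}$ with $\ell_i\in\mathsf{F}[A\setminus\{a_i\}]$ ($i=1,2$) for some distinct $a_1,a_2\in A$. For a bijection $h\colon A\to B$: $\mathrm{Split}^{\mathsf{F}}[h]=h$ if $|A|\le1$, and for $|A|\ge2$, $\mathrm{Split}^{\mathsf{F}}[h](\{\ell_1,\ell_2\})=\{\mathsf{F}[h|_{A_1}](\ell_1),\mathsf{F}[h|_{A_2}](\ell_2)\}$, where $A_i$ is the set with $\ell_i\in\mathsf{F}[A_i]$. A splitting is a natural transformation $\sigma^{\mathsf{F}}\colon\mathsf{F}\to\mathrm{Split}^{\mathsf{F}}$. Proximity: for every finite $A$ with $|A|\ge2$ and $\ell\in\mathsf{F}[A]$, if $\sigma^{\mathsf{F}}_A(\ell)=\{\ell_1,\ell_2\}$ with $\ell_i\in\mathsf{F}[A_i]$, then $|\sigma^{\mathsf{F}}_{A_1}(\ell_1)\,\triangle\,\sigma^{\mathsf{F}}_{A_2}(\ell_2)|=2$ ($\triangle$ = symmetric difference). Mergeability: for every finite $A$ with $|A|\ge2$ and every $\{\ell_1,\ell_2\}\in\mathrm{Split}^{\mathsf{F}}[A]$ with $\ell_i\in\mathsf{F}[A_i]$ and $|\sigma^{\mathsf{F}}_{A_1}(\ell_1)\,\triangle\,\sigma^{\mathsf{F}}_{A_2}(\ell_2)|=2$,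 there is a unique $\ell\in\mathsf{F}[A]$ with $\sigma^{\mathsf{F}}_A(\ell)=\{\ell_1,\ell_2\}$. Convention: when $|A|=2$ (so each $A_i$ is a singleton $\{b_i\}$ and $\sigma_{A_i}(\ell_i)=b_i$), the values are read as singletons $\{b_1\},\{b_2\}$, so the condition $|\cdot\triangle\cdot|=2$ holds automatically; for $|A|\ge3$ the condition is equivalent to $\sigma^{\mathsf{F}}_{A_1}(\ell_1)$ and $\sigma^{\mathsf{F}}_{A_2}(\ell_2)$ sharing exactly one element. Given $\eta\colon\mathsf{F}\to\mathsf{G}$, $\mathrm{Split}^{\eta}_A\colon\mathrm{Split}^{\mathsf{F}}[A]\to\mathrm{Split}^{\mathsf{G}}[A]$ is $\mathrm{id}_A$ if $|A|\le1$ and $\{\ell_1,\ell_2\}\mapsto\{\eta_{A_1}(\ell_1),\eta_{A_2}(\ell_2)\}$ (with $\ell_i\in\mathsf{F}[A_i]$) if $|A|\ge2$. -}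

module Defs where

open import Level using (0ℓ)
open import Data.Nat using (ℕ; zero; suc; _<_)
open import Data.Fin using (Fin; zero; suc)
open import Data.Vec using (Vec; []; _∷_; removeAt)
open import Data.Vec.Relation.Unary.All using (All; []; _∷_)
open import Data.Fin.Permutation using (Permutation′; _⟨$⟩ʳ_; _⟨$⟩ˡ_; id; _∘ₚ_; remove; inverseˡ)
open import Data.Product using (Σ; ∃-syntax; _×_; _,_; proj₁; proj₂)
open import Data.Sum using (_⊎_)
open import Data.Unit using (⊤)
open import Relation.Binary.PropositionalEquality using (_≡_; _≢_; refl; sym; trans; cong)
open import Function.Bundles using (_↔_; Inverse)
open import Function.Definitions using (Bijective)

-- A finite set of size n is a finite
-- subset of ℕ, represented canonically by its strictly increasing
-- enumeration (so equal subsets are equal as values of FinSet n; the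
-- sortedness proof is irrelevant).  Its elements are identified with
-- their positions Fin n in the enumeration (the actual label of
-- position i is  lookup (elems A) i ).

data Increasing : ∀ {n} → Vec ℕ n → Set where
  []  : Increasing []
  _∷_ : ∀ {n x} {xs : Vec ℕ n} → All (x <_) xs → Increasing xs → Increasing (x ∷ xs)

All-removeAt : ∀ {n} {P : ℕ → Set} (xs : Vec ℕ (suc n)) (i : Fin (suc n)) →
               All P xs → All P (removeAt xs i)
All-removeAt (x ∷ xs) zero (px ∷ pxs) = pxs
All-removeAt (x ∷ (y ∷ ys)) (suc i) (px ∷ pxs) = px ∷ All-removeAt (y ∷ ys) i pxs

Increasing-removeAt : ∀ {n} (xs : Vec ℕ (suc n)) (i : Fin (suc n)) →
                      Increasing xs → Increasing (removeAt xs i)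
Increasing-removeAt (x ∷ xs) zero (a ∷ inc) = inc
Increasing-removeAt (x ∷ (y ∷ ys)) (suc i) (a ∷ inc) =
  All-removeAt (y ∷ ys) i a ∷ Increasing-removeAt (y ∷ ys) i inc

record FinSet (n : ℕ) : Set where
  constructor mkFinSet
  field
    elems : Vec ℕ n
    .increasing : Increasing elems

El : ∀ {n} → FinSet n → Set
El {n} _ = Fin n

_─_ : ∀ {n} (A : FinSet (suc n)) → El A → FinSet n
mkFinSet xs p ─ i = mkFinSet (removeAt xs i) (Increasing-removeAt xs i p)

-- A bijection A → B between finite sets of size n is a permutation of
-- Fin n (positions); for h : A → B bijective and a ∈ A, the restriction
-- h| : A ∖ {a} → B ∖ {h a} is  remove a h .

perm-injective : ∀ {n} (h : Permutation′ n) {a b : Fin n} → h ⟨$⟩ʳ a ≡ h ⟨$⟩ʳ b → a ≡ b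
perm-injective h {a} {b} e =
  trans (sym (inverseˡ h)) (trans (cong (h ⟨$⟩ˡ_) e) (inverseˡ h))

-- Species satisfying the standing conditions.
-- (ii) (disjointness of F[A], F[B] for A ≠ B) is built in: elements of
-- different F[A] live in different types and are compared as elements
-- of the total space  Σ (FinSet n) obj .
-- (i) F[A] = A for |A| ≤ 1 is rendered as an identification of F[A] with
-- El A, under which F[h] is h.

record Species : Set₁ where
  field
    obj    : ∀ {n} → FinSet n → Set
    map    : ∀ {n} (A B : FinSet n) → Permutation′ n → obj A → obj B
    finite : ∀ {n} (A : FinSet n) → ∃[ m ] (obj A ↔ Fin m)
    map-id : ∀ {n} (A : FinSet n) (x : obj A) → map A A id x ≡ x
    map-∘  : ∀ {n} (A B C : FinSet n) (h g : Permutation′ n) (x : obj A) →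
             map A C (h ∘ₚ g) x ≡ map B C g (map A B h x)
    -- bijections are equal when they agree pointwise
    map-ext : ∀ {n} (A B : FinSet n) (h g : Permutation′ n) →
              (∀ i → h ⟨$⟩ʳ i ≡ g ⟨$⟩ʳ i) → ∀ x → map A B h x ≡ map A B g x
    base₀  : (A : FinSet 0) → obj A ↔ El A
    base₁  : (A : FinSet 1) → obj A ↔ El A
    base₁-map : (A B : FinSet 1) (h : Permutation′ 1) (x : obj A) →
                Inverse.to (base₁ B) (map A B h x) ≡ h ⟨$⟩ʳ Inverse.to (base₁ A) x

open Species public

module _ (F : Species) where

  Tag : ∀ {k} → FinSet (suc (suc k)) → Set
  Tag A = Σ (El A) λ a → obj F (A ─ a)

  record UPair {k} (A : FinSet (suc (suc k))) : Set where
    constructor upair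
    field
      fst : Tag A
      snd : Tag A
      .distinct : proj₁ fst ≢ proj₁ snd

  open UPair public

  Split : ∀ {n} → FinSet n → Set
  Split {zero}        A = El A
  Split {suc zero}    A = El A
  Split {suc (suc k)} A = UPair A

  -- equality of elements of Split^F[A] (unordered pairs: up to swap)
  SplitEq : ∀ {n} (A : FinSet n) → Split A → Split A → Set
  SplitEq {zero}        A x y = x ≡ y
  SplitEq {suc zero}    A x y = x ≡ y
  SplitEq {suc (suc k)} A p q =
    (fst p ≡ fst q × snd p ≡ snd q) ⊎ (fst p ≡ snd q × snd p ≡ fst q)

  splitMap : ∀ {n} (A B : FinSet n) → Permutation′ n → Split A → Split B
  splitMap {zero}        A B h x = h ⟨$⟩ʳ x
  splitMap {suc zero}    A B h x = h ⟨$⟩ʳ x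
  splitMap {suc (suc k)} A B h (upair (a₁ , ℓ₁) (a₂ , ℓ₂) d) =
    upair (h ⟨$⟩ʳ a₁ , map F (A ─ a₁) (B ─ (h ⟨$⟩ʳ a₁)) (remove a₁ h) ℓ₁)
          (h ⟨$⟩ʳ a₂ , map F (A ─ a₂) (B ─ (h ⟨$⟩ʳ a₂)) (remove a₂ h) ℓ₂)
          (λ e → d (perm-injective h e))

  record Splitting : Set where
    field
      σ       : ∀ {n} (A : FinSet n) → obj F A → Split A
      natural : ∀ {n} (A B : FinSet n) (h : Permutation′ n) (x : obj F A) →
                SplitEq B (σ B (map F A B h x)) (splitMap A B h (σ A x))

  open Splitting public

  embed : ∀ {k} (A : FinSet (suc (suc k))) → Tag A → Σ (FinSet (suc k)) (obj F)
  embed A (a , ℓ) = (A ─ a , ℓ)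

  _∈U_ : ∀ {k} {A : FinSet (suc (suc k))} → Σ (FinSet (suc k)) (obj F) → UPair A → Set
  _∈U_ {A = A} z p = z ≡ embed A (fst p) ⊎ z ≡ embed A (snd p)

  ShareExactlyOne : ∀ {k} {A₁ A₂ : FinSet (suc (suc k))} → UPair A₁ → UPair A₂ → Set
  ShareExactlyOne {k} p q =
    ∃[ z ] (z ∈U p × z ∈U q × (∀ w → w ∈U p → w ∈U q → w ≡ z))

  -- |σ(ℓ₁) △ σ(ℓ₂)| = 2, for {ℓ₁,ℓ₂} ∈ Split^F[A], |A| = k + 2
  -- (automatic when |A| = 2; "share exactly one element" when |A| ≥ 3)
  SymDiffTwo : Splitting → ∀ {k} (A : FinSet (suc (suc k))) → UPair A → Set
  SymDiffTwo S {zero}  A p = ⊤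
  SymDiffTwo S {suc k} A p =
    ShareExactlyOne (σ S (A ─ proj₁ (fst p)) (proj₂ (fst p)))
                    (σ S (A ─ proj₁ (snd p)) (proj₂ (snd p)))

  Proximity : Splitting → Set
  Proximity S = ∀ {k} (A : FinSet (suc (suc k))) (ℓ : obj F A) → SymDiffTwo S A (σ S A ℓ)

  Mergeability : Splitting → Set
  Mergeability S = ∀ {k} (A : FinSet (suc (suc k))) (p : UPair A) → SymDiffTwo S A p →
    ∃[ ℓ ] (SplitEq A (σ S A ℓ) p × (∀ ℓ′ → SplitEq A (σ S A ℓ′) p → ℓ′ ≡ ℓ))

record NatTrans (F G : Species) : Set where
  field
    η       : ∀ {n} (A : FinSet n) → obj F A → obj G A
    natural : ∀ {n} (A B : FinSet n) (h : Permutation′ n) (x : obj F A) →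
              η B (map F A B h x) ≡ map G A B h (η A x)

open NatTrans public

IsNatIso : ∀ {F G} → NatTrans F G → Set
IsNatIso t = ∀ {n} (A : FinSet n) → Bijective _≡_ _≡_ (η t A)

splitη : ∀ {F G} → NatTrans F G → ∀ {n} (A : FinSet n) → Split F A → Split G A
splitη t {zero}        A x = x
splitη t {suc zero}    A x = x
splitη t {suc (suc k)} A (upair (a₁ , ℓ₁) (a₂ , ℓ₂) d) =
  upair (a₁ , η t (A ─ a₁) ℓ₁) (a₂ , η t (A ─ a₂) ℓ₂) d

Commutes : ∀ {F G} → Splitting F → Splitting G → NatTrans F G → Set
Commutes {F} {G} σF σG t = ∀ {n} (A : FinSet n) (x : obj F A) →
  SplitEq G A (σ σG A (η t A x)) (splitη t A (σ σF A x))

{-# OPTIONS --safe #-}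
module Submission where

-- Build η by induction on |A|.  On sets of size ≤ 1 both species are
-- forced.  On a larger A, push σ^F(ℓ) = {ℓ₁, ℓ₂} forward along the η
-- already built one size down and merge the result in G.  The merge is
-- legal because that smaller η is injective and commutes with the
-- splittings, so it carries "σ(ℓ₁) and σ(ℓ₂) share exactly one element"
-- from F to G and back.  The uniqueness clause of mergeability makes
-- every σ injective, which yields injectivity, naturality and
-- uniqueness of η; surjectivity is the same merge run from G to F.

open import Axiom.UniquenessOfIdentityProofs.WithK using (uip)
open import Data.Empty using (⊥-elim)
open import Data.Fin using (Fin; zero)
open import Data.Fin.Permutation using (Permutation′; _⟨$⟩ʳ_; remove)
open import Data.Nat using (ℕ; zero; suc)
open import Data.Product using (Σ; ∃-syntax; _×_; _,_; proj₁; proj₂; map₂)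
import Data.Product as Product
open import Data.Product.Properties using (,-injectiveˡ; ,-injectiveʳ-UIP)
open import Data.Sum using (_⊎_; inj₁; inj₂)
import Data.Sum as Sum
open import Data.Unit using (tt)
open import Function.Bundles using (Inverse)
open import Function.Consequences.Propositional using (strictlySurjective⇒surjective)
open import Function.Definitions using (Injective; StrictlySurjective)
open import Level using (0ℓ)
open import Relation.Binary.Bundles using (Setoid)
open import Relation.Binary.PropositionalEquality
  using (_≡_; refl; sym; trans; cong; subst; module ≡-Reasoning)
open import Relation.Nullary using (¬_)

open import Defs

-- Unordered pairs as ordered pairs up to swapping: SplitEq H A p q unfolds
-- to (fst p , snd p) ≐ (fst q , snd q), and ShareExactlyOne to ShareOne of
-- the embedded components.
module _ {X : Set} where

  infix 4 _≐_ _∈₂_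

  _≐_ : X × X → X × X → Set
  (x₁ , x₂) ≐ (y₁ , y₂) = (x₁ ≡ y₁ × x₂ ≡ y₂) ⊎ (x₁ ≡ y₂ × x₂ ≡ y₁)

  _∈₂_ : X → X × X → Set
  z ∈₂ (x₁ , x₂) = z ≡ x₁ ⊎ z ≡ x₂

  ShareOne : X × X → X × X → Set
  ShareOne u v = ∃[ z ] (z ∈₂ u × z ∈₂ v × ∀ w → w ∈₂ u → w ∈₂ v → w ≡ z)

  ≐-refl : ∀ {u} → u ≐ u
  ≐-refl = inj₁ (refl , refl)

  ≐-sym : ∀ {u v} → u ≐ v → v ≐ u
  ≐-sym (inj₁ (e₁ , e₂)) = inj₁ (sym e₁ , sym e₂)
  ≐-sym (inj₂ (e₁ , e₂)) = inj₂ (sym e₂ , sym e₁)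

  ≐-trans : ∀ {u v w} → u ≐ v → v ≐ w → u ≐ w
  ≐-trans (inj₁ (e₁ , e₂)) (inj₁ (f₁ , f₂)) = inj₁ (trans e₁ f₁ , trans e₂ f₂)
  ≐-trans (inj₁ (e₁ , e₂)) (inj₂ (f₁ , f₂)) = inj₂ (trans e₁ f₁ , trans e₂ f₂)
  ≐-trans (inj₂ (e₁ , e₂)) (inj₁ (f₁ , f₂)) = inj₂ (trans e₁ f₂ , trans e₂ f₁)
  ≐-trans (inj₂ (e₁ , e₂)) (inj₂ (f₁ , f₂)) = inj₁ (trans e₁ f₂ , trans e₂ f₁)

  ∈₂-resp-≐ : ∀ {z u v} → u ≐ v → z ∈₂ u → z ∈₂ v
  ∈₂-resp-≐ (inj₁ (e₁ , _)) (inj₁ z≡x₁) = inj₁ (trans z≡x₁ e₁)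
  ∈₂-resp-≐ (inj₁ (_ , e₂)) (inj₂ z≡x₂) = inj₂ (trans z≡x₂ e₂)
  ∈₂-resp-≐ (inj₂ (e₁ , _)) (inj₁ z≡x₁) = inj₂ (trans z≡x₁ e₁)
  ∈₂-resp-≐ (inj₂ (_ , e₂)) (inj₂ z≡x₂) = inj₁ (trans z≡x₂ e₂)

  ShareOne-resp-≐ : ∀ {u u′ v v′} → u ≐ u′ → v ≐ v′ → ShareOne u v → ShareOne u′ v′
  ShareOne-resp-≐ u≐u′ v≐v′ (z , z∈u , z∈v , unique) =
    z , ∈₂-resp-≐ u≐u′ z∈u , ∈₂-resp-≐ v≐v′ z∈v ,
    λ w w∈u′ w∈v′ → unique w (∈₂-resp-≐ (≐-sym u≐u′) w∈u′) (∈₂-resp-≐ (≐-sym v≐v′) w∈v′)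

module _ {X Y : Set} (f : X → Y) where

  private
    f² : X × X → Y × Y
    f² = Product.map f f

  ≐-cong : ∀ {u v} → u ≐ v → f² u ≐ f² v
  ≐-cong = Sum.map (Product.map (cong f) (cong f)) (Product.map (cong f) (cong f))

  ∈₂-map⁺ : ∀ {z u} → z ∈₂ u → f z ∈₂ f² u
  ∈₂-map⁺ = Sum.map (cong f) (cong f)

  ∈₂-map⁻ : ∀ {w u} → w ∈₂ f² u → ∃[ z ] (z ∈₂ u × w ≡ f z)
  ∈₂-map⁻ {u = x₁ , _} (inj₁ w≡fx₁) = x₁ , inj₁ refl , w≡fx₁
  ∈₂-map⁻ {u = _ , x₂} (inj₂ w≡fx₂) = x₂ , inj₂ refl , w≡fx₂

  module _ (f-injective : Injective _≡_ _≡_ f) where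

    ≐-injective : ∀ {u v} → f² u ≐ f² v → u ≐ v
    ≐-injective = Sum.map (Product.map f-injective f-injective)
                          (Product.map f-injective f-injective)

    ∈₂-map-reflects : ∀ {z u} → f z ∈₂ f² u → z ∈₂ u
    ∈₂-map-reflects = Sum.map f-injective f-injective

    ShareOne-map⁺ : ∀ {u v} → ShareOne u v → ShareOne (f² u) (f² v)
    ShareOne-map⁺ {u} {v} (z , z∈u , z∈v , unique) = f z , ∈₂-map⁺ z∈u , ∈₂-map⁺ z∈v , only-fz
      where
      only-fz : ∀ w → w ∈₂ f² u → w ∈₂ f² v → w ≡ f z
      only-fz w w∈fu w∈fv with x , x∈u , refl ← ∈₂-map⁻ w∈fu =
        cong f (unique x x∈u (∈₂-map-reflects w∈fv))

    ShareOne-map⁻ : ∀ {u v} → ShareOne (f² u) (f² v) → ShareOne u v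
    ShareOne-map⁻ (w , w∈fu , w∈fv , unique) with z , z∈u , refl ← ∈₂-map⁻ w∈fu =
      z , z∈u , ∈₂-map-reflects w∈fv ,
      λ x x∈u x∈v → f-injective (unique (f x) (∈₂-map⁺ x∈u) (∈₂-map⁺ x∈v))

map₂-injective : ∀ {A : Set} {B C : A → Set} {f : ∀ {a} → B a → C a} →
                 (∀ {a} → Injective _≡_ _≡_ (f {a})) → Injective _≡_ _≡_ (map₂ {B = B} {C} f)
map₂-injective f-injective {a , _} eq with refl ← ,-injectiveˡ eq =
  cong (a ,_) (f-injective (,-injectiveʳ-UIP uip eq))

Fin1-irrelevant : (i j : Fin 1) → i ≡ j
Fin1-irrelevant zero zero = refl

module _ (H : Species) where

  obj-empty : (A : FinSet 0) → ¬ obj H A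
  obj-empty A x with () ← Inverse.to (base₀ H A) x

  obj-irrelevant : (A : FinSet 1) (x y : obj H A) → x ≡ y
  obj-irrelevant A x y = begin
    x            ≡⟨ strictlyInverseʳ x ⟨
    from (to x)  ≡⟨ cong from (Fin1-irrelevant (to x) (to y)) ⟩
    from (to y)  ≡⟨ strictlyInverseʳ y ⟩
    y            ∎
    where open Inverse (base₁ H A) using (to; from; strictlyInverseʳ)
          open ≡-Reasoning

  UPair-≡ : ∀ {k} {A : FinSet (suc (suc k))} {p q : UPair H A} →
            fst p ≡ fst q → snd p ≡ snd q → p ≡ q
  UPair-≡ refl refl = refl

  UPairSetoid : ∀ {k} (A : FinSet (suc (suc k))) → Setoid 0ℓ 0ℓ
  UPairSetoid A = record
    { Carrier       = UPair H A
    ; _≈_           = SplitEq H A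
    ; isEquivalence = record { refl = ≐-refl ; sym = ≐-sym ; trans = ≐-trans }
    }

  splitMapTag : ∀ {k} (A B : FinSet (suc (suc k))) → Permutation′ (suc (suc k)) → Tag H A → Tag H B
  splitMapTag A B h (a , ℓ) = h ⟨$⟩ʳ a , map H (A ─ a) (B ─ (h ⟨$⟩ʳ a)) (remove a h) ℓ

  σ-injective : (S : Splitting H) → Proximity H S → Mergeability H S →
                ∀ {k} (A : FinSet (suc (suc k))) {x y : obj H A} →
                SplitEq H A (σ S A x) (σ S A y) → x ≡ y
  σ-injective S prox merge A {x} {y} σx≐σy with _ , _ , unique ← merge A (σ S A x) (prox A x) =
    trans (unique x ≐-refl) (sym (unique y (≐-sym σx≐σy)))

module Maps (F G : Species) where

  Family : ℕ → Set
  Family n = (A : FinSet n) → obj F A → obj G A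

  IsNatural : ∀ {n} → Family n → Set
  IsNatural e = ∀ A B h x → e B (map F A B h x) ≡ map G A B h (e A x)

  module _ {k} (e : Family (suc k)) where

    mapTag : (A : FinSet (suc (suc k))) → Tag F A → Tag G A
    mapTag A (a , ℓ) = a , e (A ─ a) ℓ

    mapUPair : (A : FinSet (suc (suc k))) → UPair F A → UPair G A
    mapUPair A (upair s t d) = upair (mapTag A s) (mapTag A t) d

    mapΣ : Σ (FinSet (suc k)) (obj F) → Σ (FinSet (suc k)) (obj G)
    mapΣ (C , x) = C , e C x

    mapUPair-splitMap : IsNatural e → ∀ A B h p →
                        mapUPair B (splitMap F A B h p) ≡ splitMap G A B h (mapUPair A p)
    mapUPair-splitMap e-natural A B h (upair (a₁ , ℓ₁) (a₂ , ℓ₂) _) =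
      UPair-≡ G (cong (h ⟨$⟩ʳ a₁ ,_) (e-natural (A ─ a₁) (B ─ (h ⟨$⟩ʳ a₁)) (remove a₁ h) ℓ₁))
                (cong (h ⟨$⟩ʳ a₂ ,_) (e-natural (A ─ a₂) (B ─ (h ⟨$⟩ʳ a₂)) (remove a₂ h) ℓ₂))

    mapUPair-surjective : (∀ C → StrictlySurjective _≡_ (e C)) →
                          ∀ A → StrictlySurjective _≡_ (mapUPair A)
    mapUPair-surjective e-surjective A (upair (a₁ , m₁) (a₂ , m₂) d)
      with ℓ₁ , refl ← e-surjective (A ─ a₁) m₁ | ℓ₂ , refl ← e-surjective (A ─ a₂) m₂ =
      upair (a₁ , ℓ₁) (a₂ , ℓ₂) d , refl

    module _ (e-injective : ∀ C → Injective _≡_ _≡_ (e C)) where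

      mapTag-injective : ∀ A → Injective _≡_ _≡_ (mapTag A)
      mapTag-injective A = map₂-injective {C = λ a → obj G (A ─ a)} (e-injective _)

      mapΣ-injective : Injective _≡_ _≡_ mapΣ
      mapΣ-injective = map₂-injective {C = obj G} (e-injective _)

  mapUPair-cong : ∀ {k} {e e′ : Family (suc k)} → (∀ C x → e C x ≡ e′ C x) →
                  ∀ A p → mapUPair e A p ≡ mapUPair e′ A p
  mapUPair-cong e≗e′ A (upair (a₁ , ℓ₁) (a₂ , ℓ₂) _) =
    UPair-≡ G (cong (a₁ ,_) (e≗e′ _ ℓ₁)) (cong (a₂ ,_) (e≗e′ _ ℓ₂))

module Construction (F G : Species) (σF : Splitting F) (σG : Splitting G)
                    (proxF : Proximity F σF) (mergeF : Mergeability F σF)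
                    (proxG : Proximity G σG) (mergeG : Mergeability G σG) where

  open Maps F G

  -- η on sets of size k + 1.  Transporting SymDiffTwo both ways is what
  -- lets the merges on sets of size k + 2 go through.
  record Layer (k : ℕ) : Set where
    field
      to           : Family (suc k)
      to-injective : ∀ A → Injective _≡_ _≡_ (to A)
      symDiffTwo⁺  : ∀ A p → SymDiffTwo F σF A p → SymDiffTwo G σG A (mapUPair to A p)
      symDiffTwo⁻  : ∀ A p → SymDiffTwo G σG A (mapUPair to A p) → SymDiffTwo F σF A p

  open Layer

  layer₀ : Layer 0
  layer₀ = record
    { to           = λ A x → Inverse.from (base₁ G A) (Inverse.to (base₁ F A) x)
    ; to-injective = λ A _ → obj-irrelevant F A _ _
    ; symDiffTwo⁺  = λ _ _ _ → tt
    ; symDiffTwo⁻  = λ _ _ _ → tt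
    }

  module Extend {k} (L : Layer k) where

    module L = Layer L

    private
      pushed-symDiffTwo : ∀ A (x : obj F A) → SymDiffTwo G σG A (mapUPair L.to A (σ σF A x))
      pushed-symDiffTwo A x = L.symDiffTwo⁺ A (σ σF A x) (proxF A x)

    to′ : Family (suc (suc k))
    to′ A x = proj₁ (mergeG A _ (pushed-symDiffTwo A x))

    commutes : ∀ A x → SplitEq G A (σ σG A (to′ A x)) (mapUPair L.to A (σ σF A x))
    commutes A x = proj₁ (proj₂ (mergeG A _ (pushed-symDiffTwo A x)))

    to′-injective : ∀ A → Injective _≡_ _≡_ (to′ A)
    to′-injective A {x} {y} to′x≡to′y =
      σ-injective F σF proxF mergeF A
        (≐-injective (mapTag L.to A) (mapTag-injective L.to L.to-injective A) (begin
          mapUPair L.to A (σ σF A x)  ≈⟨ commutes A x ⟨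
          σ σG A (to′ A x)            ≡⟨ cong (σ σG A) to′x≡to′y ⟩
          σ σG A (to′ A y)            ≈⟨ commutes A y ⟩
          mapUPair L.to A (σ σF A y)  ∎))
      where open import Relation.Binary.Reasoning.Setoid (UPairSetoid G A)

    to′-symDiffTwo⁺ : ∀ A p → SymDiffTwo F σF A p → SymDiffTwo G σG A (mapUPair to′ A p)
    to′-symDiffTwo⁺ A (upair (a₁ , ℓ₁) (a₂ , ℓ₂) _) share =
      ShareOne-resp-≐ (≐-cong (embed G (A ─ a₁)) (≐-sym (commutes (A ─ a₁) ℓ₁)))
                      (≐-cong (embed G (A ─ a₂)) (≐-sym (commutes (A ─ a₂) ℓ₂)))
        (ShareOne-map⁺ (mapΣ L.to) (mapΣ-injective L.to L.to-injective) share)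

    to′-symDiffTwo⁻ : ∀ A p → SymDiffTwo G σG A (mapUPair to′ A p) → SymDiffTwo F σF A p
    to′-symDiffTwo⁻ A (upair (a₁ , ℓ₁) (a₂ , ℓ₂) _) share =
      ShareOne-map⁻ (mapΣ L.to) (mapΣ-injective L.to L.to-injective)
        (ShareOne-resp-≐ (≐-cong (embed G (A ─ a₁)) (commutes (A ─ a₁) ℓ₁))
                         (≐-cong (embed G (A ─ a₂)) (commutes (A ─ a₂) ℓ₂)) share)

    layer : Layer (suc k)
    layer = record
      { to           = to′
      ; to-injective = to′-injective
      ; symDiffTwo⁺  = to′-symDiffTwo⁺
      ; symDiffTwo⁻  = to′-symDiffTwo⁻
      }

    to′-natural : IsNatural L.to → IsNatural to′
    to′-natural L-natural A B h x = σ-injective G σG proxG mergeG B (begin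
      σ σG B (to′ B (map F A B h x))                 ≈⟨ commutes B (map F A B h x) ⟩
      mapUPair L.to B (σ σF B (map F A B h x))       ≈⟨ ≐-cong (mapTag L.to B) (natural σF A B h x) ⟩
      mapUPair L.to B (splitMap F A B h (σ σF A x))  ≡⟨ mapUPair-splitMap L.to L-natural A B h (σ σF A x) ⟩
      splitMap G A B h (mapUPair L.to A (σ σF A x))  ≈⟨ ≐-cong (splitMapTag G A B h) (commutes A x) ⟨
      splitMap G A B h (σ σG A (to′ A x))            ≈⟨ natural σG A B h (to′ A x) ⟨
      σ σG B (map G A B h (to′ A x))                 ∎)
      where open import Relation.Binary.Reasoning.Setoid (UPairSetoid G B)

    to′-surjective : (∀ C → StrictlySurjective _≡_ (L.to C)) → ∀ A → StrictlySurjective _≡_ (to′ A)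
    to′-surjective L-surjective A y
      with p , p↦σy ← mapUPair-surjective L.to L-surjective A (σ σG A y)
      with x , σx≐p , _ ←
             mergeF A p (L.symDiffTwo⁻ A p (subst (SymDiffTwo G σG A) (sym p↦σy) (proxG A y)))
      = x , σ-injective G σG proxG mergeG A (begin
        σ σG A (to′ A x)            ≈⟨ commutes A x ⟩
        mapUPair L.to A (σ σF A x)  ≈⟨ ≐-cong (mapTag L.to A) σx≐p ⟩
        mapUPair L.to A p           ≡⟨ p↦σy ⟩
        σ σG A y                    ∎)
      where open import Relation.Binary.Reasoning.Setoid (UPairSetoid G A)

  layer : ∀ k → Layer k
  layer zero    = layer₀
  layer (suc k) = Extend.layer (layer k)

  layer-natural : ∀ k → IsNatural (to (layer k))
  layer-natural zero    A B h x = obj-irrelevant G B _ _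
  layer-natural (suc k) = Extend.to′-natural (layer k) (layer-natural k)

  layer-surjective : ∀ k A → StrictlySurjective _≡_ (to (layer k) A)
  layer-surjective zero A y =
    Inverse.from (base₁ F A) (Inverse.to (base₁ G A) y) , obj-irrelevant G A _ _
  layer-surjective (suc k) = Extend.to′-surjective (layer k) (layer-surjective k)

  canonical-η : ∀ {n} → Family n
  canonical-η {zero}  A x = ⊥-elim (obj-empty F A x)
  canonical-η {suc k} = to (layer k)

  canonical : NatTrans F G
  canonical = record { η = canonical-η ; natural = canonical-natural }
    where
    canonical-natural : ∀ {n} → IsNatural (canonical-η {n})
    canonical-natural {zero}  A _ _ x = ⊥-elim (obj-empty F A x)
    canonical-natural {suc k} = layer-natural k

  canonical-commutes : Commutes σF σG canonical
  canonical-commutes {zero}        A x = ⊥-elim (obj-empty F A x)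
  canonical-commutes {suc zero}    A x = Fin1-irrelevant _ _
  canonical-commutes {suc (suc k)} A x = Extend.commutes (layer k) A x

  canonical-unique : (t : NatTrans F G) → Commutes σF σG t →
                     ∀ {n} (A : FinSet n) x → η t A x ≡ canonical-η A x
  canonical-unique t t-commutes {zero}        A x = ⊥-elim (obj-empty F A x)
  canonical-unique t t-commutes {suc zero}    A x = obj-irrelevant G A _ _
  canonical-unique t t-commutes {suc (suc k)} A x = σ-injective G σG proxG mergeG A (begin
    σ σG A (η t A x)                      ≈⟨ t-commutes A x ⟩
    mapUPair (η t) A (σ σF A x)           ≡⟨ mapUPair-cong (canonical-unique t t-commutes) A (σ σF A x) ⟩
    mapUPair (to (layer k)) A (σ σF A x)  ≈⟨ Extend.commutes (layer k) A x ⟨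
    σ σG A (to (layer (suc k)) A x)       ∎)
    where open import Relation.Binary.Reasoning.Setoid (UPairSetoid G A)

  canonical-isNatIso : IsNatIso canonical
  canonical-isNatIso {zero}  A =
    (λ {x} _ → ⊥-elim (obj-empty F A x)) , λ y → ⊥-elim (obj-empty G A y)
  canonical-isNatIso {suc k} A =
    to-injective (layer k) A , strictlySurjective⇒surjective (layer-surjective k A)

theorem3p7 : (F G : Species) (σF : Splitting F) (σG : Splitting G) →
    Proximity F σF → Mergeability F σF →
    Proximity G σG → Mergeability G σG →
    Σ (NatTrans F G) (λ t →
      Commutes σF σG t ×
      ((t′ : NatTrans F G) → Commutes σF σG t′ →
        ∀ {n} (A : FinSet n) (x : obj F A) → η t′ A x ≡ η t A x) ×
      IsNatIso t)
theorem3p7 F G σF σG proxF mergeF proxG mergeG =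
  canonical , canonical-commutes , canonical-unique , canonical-isNatIso
  where open Construction F G σF σG proxF mergeF proxG mergeG
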